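{- Let $\Sigma\subseteq\mathcal{L}_{\mathrm{DTDS}}$ be a finite filtration-ready set and let $\sim$ and $R^c_\Box$ be as in the context. Then ${\sim}\circ R^c_\Box=R^c_\Box\circ{\sim}$.
   Context: Fix a finite non-empty set of agents $\mathsf{Agt}$ and a countably infinite set $\mathsf{Prop}$. $\mathcal{L}_{\mathrm{DTDS}}$: $\varphi::=p\mid\neg\varphi\mid(\varphi\land\varphi)\mid\Box\varphi\mid[i]\varphi\mid[\mathsf{Agt}]\varphi\mid\mathsf{O}_i\varphi\mid\mathsf{X}\varphi\mid\mathsf{U}(\varphi,\varphi)$. $\mathsf{L}_{\mathrm{DTDS}}$ is the smallest set of formulas containing all instances (for all $i$) of: propositional tautologies; K,T,4,5 for $\Box,[i],[\mathsf{Agt}]$; K for $\mathsf{O}_i,\mathsf{X}$; $\Box\varphi\to[i]\varphi$; $\bigwedge_i\Diamond[i]\varphi_i\to\Diamond\bigwedge_i[i]\varphi_i$; $\bigwedge_i[i]\varphi_i\to[\mathsf{Agt}]\bigwedge_i\varphi_i$; $[\mathsf{Agt}]\mathsf{X}\varphi\to\mathsf{X}\Box\varphi$; $\Box\varphi\to\mathsf{O}_i\varphi$; $\mathsf{O}_i\varphi\to\neg\mathsf{O}_i\neg\varphi$; $\mathsf{O}_i\varphi\to\mathsf{O}_i[i]\varphi$; $\mathsf{O}_i\varphi\to\Box\mathsf{O}_i\varphi$; $\mathsf{X}\varphi\leftrightarrow\neg\mathsf{X}\neg\varphi$; $\mathsf{U}(\varphi,\psi)\leftrightarrow(\varphi\lor(\psi\land\mathsf{X}\mathsf{U}(\varphi,\psi)))$;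 closed under modus ponens, necessitation for $\Box,[\mathsf{Agt}],\mathsf{X},[i],\mathsf{O}_i$, and: from $\chi\to(\neg\varphi\land\mathsf{X}\chi)$ infer $\chi\to\neg\mathsf{U}(\varphi,\psi)$. Canonical model: $S^c$ is the set of maximal $\mathsf{L}_{\mathrm{DTDS}}$-consistent sets; $wR^c_\Box v$ iff $\varphi\in v$ whenever $\Box\varphi\in w$. $\Sigma$ is filtration-ready if it is closed under subformulas; closed under $\dot\neg$ (where $\dot\neg\neg\psi=\psi$ and $\dot\neg\psi=\neg\psi$ if $\psi$ does not begin with $\neg$); $\mathsf{U}(\alpha,\beta)\in\Sigma$ implies $\mathsf{X}\mathsf{U}(\alpha,\beta)\in\Sigma$; and $\mathsf{O}_i\varphi\in\Sigma$ implies $[i]\varphi\in\Sigma$. For $w\in S^c$, $\Sigma(w)=w\cap\Sigma$, and $w\sim v$ iff $\Sigma(w)=\Sigma(v)$ and $\{\Sigma(x)\mid wR^c_\Box x\}=\{\Sigma(x)\mid vR^c_\Box x\}$. Composition: $x(R\circ R')y$ iff $xRz$ and $zR'y$ for some $z$. -}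

module Defs where

open import Level using (Level; _⊔_) renaming (suc to lsuc; zero to lzero)
open import Data.Nat using (ℕ; zero; suc)
open import Data.Fin using (Fin; zero; suc)
open import Data.Bool using (Bool; true; false; not; _∧_)
open import Data.List using (List; []; _∷_)
open import Data.List.Relation.Unary.All using (All)
open import Data.List.Membership.Propositional using (_∈_)
open import Data.Product using (Σ; ∃; _×_; _,_; proj₁)
open import Data.Sum using (_⊎_)
open import Relation.Binary.PropositionalEquality using (_≡_)
open import Relation.Nullary using (¬_)
open import Function.Bundles using (_⇔_)

-- Agt = Fin (suc n)  (finite, non-empty);  Prop = ℕ (countably infinite).
data Fm (n : ℕ) : Set where
  var  : ℕ → Fm n
  ~_   : Fm n → Fm n
  _∧'_ : Fm n → Fm n → Fm n
  □_   : Fm n → Fm n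
  [_]_ : Fin (suc n) → Fm n → Fm n
  [Agt]_ : Fm n → Fm n
  O    : Fin (suc n) → Fm n → Fm n
  X    : Fm n → Fm n
  U    : Fm n → Fm n → Fm n

infixr 8 ~_ □_ [_]_ [Agt]_
infixl 5 _∧'_

module _ {n : ℕ} where

  infixr 4 _⇒_
  infixl 5 _∨'_
  infix 3 _⇔'_
  infixr 8 ◇_

  _⇒_ : Fm n → Fm n → Fm n
  φ ⇒ ψ = ~ (φ ∧' ~ ψ)

  _∨'_ : Fm n → Fm n → Fm n
  φ ∨' ψ = ~ (~ φ ∧' ~ ψ)

  _⇔'_ : Fm n → Fm n → Fm n
  φ ⇔' ψ = (φ ⇒ ψ) ∧' (ψ ⇒ φ)

  ◇_ : Fm n → Fm n
  ◇ φ = ~ □ ~ φ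

  ⊤' : Fm n
  ⊤' = ~ (var 0 ∧' ~ var 0)

  ⋀ : ∀ {k} → (Fin (suc k) → Fm n) → Fm n
  ⋀ {zero}  f = f zero
  ⋀ {suc k} f = f zero ∧' ⋀ {k} (λ i → f (suc i))

  conj : List (Fm n) → Fm n
  conj []       = ⊤'
  conj (φ ∷ φs) = φ ∧' conj φs

  -- propositional tautologies: true under every Boolean valuation that
  -- treats every non-(¬,∧) formula as an atom
  eval : (Fm n → Bool) → Fm n → Bool
  eval v (~ φ)    = not (eval v φ)
  eval v (φ ∧' ψ) = eval v φ ∧ eval v ψ
  eval v φ        = v φ

  Tautology : Fm n → Set
  Tautology φ = (v : Fm n → Bool) → eval v φ ≡ true

  data S5Box : Set where
    bx  : S5Box
    ag  : Fin (suc n) → S5Box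
    grd : S5Box

  ⟦_⟧ : S5Box → Fm n → Fm n
  ⟦ bx ⟧  φ = □ φ
  ⟦ ag i ⟧ φ = [ i ] φ
  ⟦ grd ⟧ φ = [Agt] φ

  data Thm : Fm n → Set where
    taut  : ∀ {φ} → Tautology φ → Thm φ
    axK   : ∀ b φ ψ → Thm (⟦ b ⟧ (φ ⇒ ψ) ⇒ (⟦ b ⟧ φ ⇒ ⟦ b ⟧ ψ))
    axT   : ∀ b φ → Thm (⟦ b ⟧ φ ⇒ φ)
    ax4   : ∀ b φ → Thm (⟦ b ⟧ φ ⇒ ⟦ b ⟧ (⟦ b ⟧ φ))
    ax5   : ∀ b φ → Thm (~ ⟦ b ⟧ (~ φ) ⇒ ⟦ b ⟧ (~ ⟦ b ⟧ (~ φ)))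
    axKO  : ∀ i φ ψ → Thm (O i (φ ⇒ ψ) ⇒ (O i φ ⇒ O i ψ))
    axKX  : ∀ φ ψ → Thm (X (φ ⇒ ψ) ⇒ (X φ ⇒ X ψ))
    axSET : ∀ i φ → Thm (□ φ ⇒ [ i ] φ)
    axIA  : ∀ (f : Fin (suc n) → Fm n) →
            Thm (⋀ (λ i → ◇ ([ i ] f i)) ⇒ ◇ ⋀ (λ i → [ i ] f i))
    axGrd : ∀ (f : Fin (suc n) → Fm n) →
            Thm (⋀ (λ i → [ i ] f i) ⇒ [Agt] ⋀ f)
    axNC  : ∀ φ → Thm ([Agt] X φ ⇒ X (□ φ))
    axOb1 : ∀ i φ → Thm (□ φ ⇒ O i φ)
    axOb2 : ∀ i φ → Thm (O i φ ⇒ ~ O i (~ φ))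
    axOb3 : ∀ i φ → Thm (O i φ ⇒ O i ([ i ] φ))
    axOb4 : ∀ i φ → Thm (O i φ ⇒ □ O i φ)
    axFun : ∀ φ → Thm (X φ ⇔' ~ X (~ φ))
    axU   : ∀ φ ψ → Thm (U φ ψ ⇔' (φ ∨' (ψ ∧' X (U φ ψ))))
    mp    : ∀ {φ ψ} → Thm (φ ⇒ ψ) → Thm φ → Thm ψ
    necB  : ∀ b {φ} → Thm φ → Thm (⟦ b ⟧ φ)
    necX  : ∀ {φ} → Thm φ → Thm (X φ)
    necO  : ∀ i {φ} → Thm φ → Thm (O i φ)
    indU  : ∀ {χ φ ψ} → Thm (χ ⇒ (~ φ ∧' X χ)) → Thm (χ ⇒ ~ U φ ψ)

  FmSet : Set₁
  FmSet = Fm n → Set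

  Consistent : FmSet → Set
  Consistent Γ = ¬ (Σ (List (Fm n)) λ l → All Γ l × Thm (~ conj l))

  _∪｛_｝ : FmSet → Fm n → FmSet
  (Γ ∪｛ φ ｝) ψ = Γ ψ ⊎ ψ ≡ φ

  MaxConsistent : FmSet → Set
  MaxConsistent Γ = Consistent Γ × (∀ φ → Consistent (Γ ∪｛ φ ｝) → Γ φ)

  Sc : Set₁
  Sc = Σ FmSet MaxConsistent

  _∋_ : Sc → Fm n → Set
  w ∋ φ = proj₁ w φ

  Rc : Sc → Sc → Set
  Rc w v = ∀ φ → w ∋ (□ φ) → v ∋ φ

  ¬̇ : Fm n → Fm n
  ¬̇ (~ ψ) = ψ
  ¬̇ ψ     = ~ ψ

  data ImmSub : Fm n → Fm n → Set where
    s~   : ∀ φ → ImmSub φ (~ φ)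
    s∧l  : ∀ φ ψ → ImmSub φ (φ ∧' ψ)
    s∧r  : ∀ φ ψ → ImmSub ψ (φ ∧' ψ)
    s□   : ∀ φ → ImmSub φ (□ φ)
    s[i] : ∀ i φ → ImmSub φ ([ i ] φ)
    sAgt : ∀ φ → ImmSub φ ([Agt] φ)
    sO   : ∀ i φ → ImmSub φ (O i φ)
    sX   : ∀ φ → ImmSub φ (X φ)
    sUl  : ∀ φ ψ → ImmSub φ (U φ ψ)
    sUr  : ∀ φ ψ → ImmSub ψ (U φ ψ)

  -- a finite set Σ given by a list
  record FiltrationReady (Sg : List (Fm n)) : Set where
    field
      subClosed : ∀ {φ ψ} → φ ∈ Sg → ImmSub ψ φ → ψ ∈ Sg
      negClosed : ∀ {φ} → φ ∈ Sg → ¬̇ φ ∈ Sg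
      UClosed   : ∀ {α β} → U α β ∈ Sg → X (U α β) ∈ Sg
      OClosed   : ∀ {i φ} → O i φ ∈ Sg → ([ i ] φ) ∈ Sg

  SameΣ : List (Fm n) → Sc → Sc → Set
  SameΣ Sg w v = ∀ φ → φ ∈ Sg → (w ∋ φ ⇔ v ∋ φ)

  -- w ∼ v : Σ(w)=Σ(v) and {Σ(x) | w R x} = {Σ(x) | v R x}
  Sim : List (Fm n) → Sc → Sc → Set₁
  Sim Sg w v = SameΣ Sg w v
             × (∀ x → Rc w x → ∃ λ y → Rc v y × SameΣ Sg x y)
             × (∀ y → Rc v y → ∃ λ x → Rc w x × SameΣ Sg x y)

_∘ᴿ_ : ∀ {a ℓ₁ ℓ₂} {A : Set a} → (A → A → Set ℓ₁) → (A → A → Set ℓ₂) → A → A → Set (a ⊔ ℓ₁ ⊔ ℓ₂)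
(R ∘ᴿ R') x y = ∃ λ z → R x z × R' z y

{-# OPTIONS --safe #-}
-- R^c_□ is an equivalence relation, because □ is an S5 modality. The second
-- clause of w ∼ v compares the R^c_□-images of w and v, and these only depend
-- on the R^c_□-classes of w and v. Hence if w ∼ z R^c_□ v, the successor u of w
-- that matches v on Σ satisfies w R^c_□ u ∼ v; the converse inclusion is
-- symmetric.
module Submission where

open import Defs
open import Data.Nat using (ℕ; zero; suc)
open import Data.Fin using (Fin; zero; suc)
open import Data.Vec using (Vec; []; _∷_; lookup; map)
open import Data.Vec.Properties using (lookup-map)
open import Data.Bool using (Bool; true; false; not; _∧_; T)
open import Data.Bool.Properties using (T-∧; T-≡)
open import Data.List using (List; []; _∷_)
open import Data.List.Relation.Unary.All using (All; []; _∷_)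
open import Data.Product using (∃; _×_; _,_; proj₁; proj₂)
open import Data.Sum using (inj₁; inj₂)
open import Function.Bundles using (_⇔_; mk⇔; Equivalence)
open import Level using (_⊔_) renaming (zero to lzero)
open import Relation.Binary.Core using (Rel)
open import Relation.Binary.Definitions using (Reflexive; Symmetric; Transitive)
open import Relation.Binary.Structures using (IsEquivalence)
open import Relation.Binary.Construct.Intersection using (_∩_)
open import Relation.Binary.PropositionalEquality using (_≡_; refl)
import Relation.Binary.PropositionalEquality as ≡
open import Relation.Nullary using (¬_)

module _ {a ℓ e} {A : Set a} (_R_ : Rel A ℓ) (_E_ : Rel A e) where

  SameImage : Rel A (a ⊔ ℓ ⊔ e)
  SameImage w v = (∀ x → w R x → ∃ λ y → v R y × x E y)
                × (∀ y → v R y → ∃ λ x → w R x × x E y)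

  Similar : Rel A (a ⊔ ℓ ⊔ e)
  Similar = _E_ ∩ SameImage

module _ {a ℓ e} {A : Set a} {_R_ : Rel A ℓ} (R-equiv : IsEquivalence _R_) (_E_ : Rel A e) where
  open IsEquivalence R-equiv

  SameImage-resp : ∀ {w w′ v v′} → w R w′ → v R v′ →
                   SameImage _R_ _E_ w v → SameImage _R_ _E_ w′ v′
  SameImage-resp wRw′ vRv′ (forth , back) =
    (λ x w′Rx → let (y , vRy , xEy) = forth x (trans wRw′ w′Rx)
                in y , trans (sym vRv′) vRy , xEy) ,
    (λ y v′Ry → let (x , wRx , xEy) = back y (trans vRv′ v′Ry)
                in x , trans (sym wRw′) wRx , xEy)

  Similar-∘-comm : ∀ w v → (Similar _R_ _E_ ∘ᴿ _R_) w v ⇔ (_R_ ∘ᴿ Similar _R_ _E_) w v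
  Similar-∘-comm w v = mk⇔ to from
    where
    to : (Similar _R_ _E_ ∘ᴿ _R_) w v → (_R_ ∘ᴿ Similar _R_ _E_) w v
    to (z , (_ , images) , zRv) =
      let (u , wRu , uEv) = proj₂ images v zRv
      in u , wRu , uEv , SameImage-resp wRu zRv images
    from : (_R_ ∘ᴿ Similar _R_ _E_) w v → (Similar _R_ _E_ ∘ᴿ _R_) w v
    from (z , wRz , (_ , images)) =
      let (u , vRu , wEu) = proj₁ images w (sym wRz)
      in u , (wEu , SameImage-resp (sym wRz) vRu images) , sym vRu

data Schema (k : ℕ) : Set where
  meta : Fin k → Schema k
  ¬ᵖ_  : Schema k → Schema k
  _∧ᵖ_ : Schema k → Schema k → Schema k

infixr 8 ¬ᵖ_
infixl 5 _∧ᵖ_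
infixr 4 _⇒ᵖ_

_⇒ᵖ_ : ∀ {k} → Schema k → Schema k → Schema k
s ⇒ᵖ t = ¬ᵖ (s ∧ᵖ ¬ᵖ t)

-- ⊤' is ⊤ᵖ P instantiated at var 0.
⊤ᵖ : ∀ {k} → Schema k → Schema k
⊤ᵖ s = ¬ᵖ (s ∧ᵖ ¬ᵖ s)

P : ∀ {k} → Schema (suc k)
P = meta zero

Q : ∀ {k} → Schema (suc (suc k))
Q = meta (suc zero)

R : ∀ {k} → Schema (suc (suc (suc k)))
R = meta (suc (suc zero))

S : ∀ {k} → Schema (suc (suc (suc (suc k))))
S = meta (suc (suc (suc zero)))

truthValue : ∀ {k} → Schema k → Vec Bool k → Bool
truthValue (meta i)  ρ = lookup ρ i
truthValue (¬ᵖ s)    ρ = not (truthValue s ρ)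
truthValue (s ∧ᵖ t)  ρ = truthValue s ρ ∧ truthValue t ρ

allValuations : ∀ {k} → (Vec Bool k → Bool) → Bool
allValuations {zero}  f = f []
allValuations {suc k} f =
  allValuations (λ ρ → f (true ∷ ρ)) ∧ allValuations (λ ρ → f (false ∷ ρ))

allValuations-sound : ∀ {k} (f : Vec Bool k → Bool) → T (allValuations f) → ∀ ρ → T (f ρ)
allValuations-sound f holds []          = holds
allValuations-sound f holds (true ∷ ρ)  = allValuations-sound _ (proj₁ (T-∧ .Equivalence.to holds)) ρ
allValuations-sound f holds (false ∷ ρ) = allValuations-sound _ (proj₂ (T-∧ .Equivalence.to holds)) ρ

module _ {n : ℕ} where

  _⟪_⟫ : ∀ {k} → Schema k → Vec (Fm n) k → Fm n
  meta i   ⟪ σ ⟫ = lookup σ i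
  (¬ᵖ s)   ⟪ σ ⟫ = ~ (s ⟪ σ ⟫)
  (s ∧ᵖ t) ⟪ σ ⟫ = s ⟪ σ ⟫ ∧' t ⟪ σ ⟫

  eval-⟪⟫ : ∀ {k} v (s : Schema k) σ → eval v (s ⟪ σ ⟫) ≡ truthValue s (map (eval v) σ)
  eval-⟪⟫ v (meta i) σ = ≡.sym (lookup-map i (eval v) σ)
  eval-⟪⟫ v (¬ᵖ s)   σ = ≡.cong not (eval-⟪⟫ v s σ)
  eval-⟪⟫ v (s ∧ᵖ t) σ = ≡.cong₂ _∧_ (eval-⟪⟫ v s σ) (eval-⟪⟫ v t σ)

  -- The truth-table argument reduces to tt for a concrete tautology, so it is found by unification.
  tautology : ∀ {k} (s : Schema k) {_ : T (allValuations (truthValue s))} (σ : Vec (Fm n) k) →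
              Thm (s ⟪ σ ⟫)
  tautology s {valid} σ = taut λ v →
    ≡.trans (eval-⟪⟫ v s σ) (Equivalence.to T-≡ (allValuations-sound (truthValue s) valid _))

  discharge : ∀ {Γ : FmSet {n}} ψ {l} → All (Γ ∪｛ ψ ｝) l →
              ∃ λ s → All Γ s × Thm (conj s ⇒ ψ ⇒ conj l)
  discharge ψ [] = [] , [] , tautology (⊤ᵖ P ⇒ᵖ Q ⇒ᵖ ⊤ᵖ P) (var 0 ∷ ψ ∷ [])
  discharge ψ {x ∷ l} (inj₁ x∈Γ ∷ l⊆) =
    let (s , s⊆ , t) = discharge ψ l⊆
    in x ∷ s , x∈Γ ∷ s⊆ ,
       mp (tautology ((P ⇒ᵖ Q ⇒ᵖ R) ⇒ᵖ S ∧ᵖ P ⇒ᵖ Q ⇒ᵖ S ∧ᵖ R) (conj s ∷ ψ ∷ conj l ∷ x ∷ [])) t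
  discharge ψ {_ ∷ l} (inj₂ refl ∷ l⊆) =
    let (s , s⊆ , t) = discharge ψ l⊆
    in s , s⊆ ,
       mp (tautology ((P ⇒ᵖ Q ⇒ᵖ R) ⇒ᵖ P ⇒ᵖ Q ⇒ᵖ Q ∧ᵖ R) (conj s ∷ ψ ∷ conj l ∷ [])) t

  module MaxConsistentSet {Γ : FmSet {n}} (mc : MaxConsistent Γ) where

    refute : ∀ {l} → All Γ l → ¬ Thm (~ conj l)
    refute l⊆ ⊢¬l = proj₁ mc (_ , l⊆ , ⊢¬l)

    ∈-intro : ∀ {φ} → (∀ {s} → All Γ s → ¬ Thm (conj s ⇒ ~ φ)) → Γ φ
    ∈-intro {φ} unrefuted = proj₂ mc φ λ (l , l⊆ , ⊢¬l) →
      let (s , s⊆ , t) = discharge φ l⊆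
      in unrefuted s⊆ (mp (mp (tautology ((P ⇒ᵖ Q ⇒ᵖ R) ⇒ᵖ ¬ᵖ R ⇒ᵖ P ⇒ᵖ ¬ᵖ Q)
                                         (conj s ∷ φ ∷ conj l ∷ [])) t) ⊢¬l)

    thm-∈ : ∀ {φ} → Thm φ → Γ φ
    thm-∈ {φ} ⊢φ = ∈-intro λ {s} s⊆ t →
      refute s⊆ (mp (mp (tautology ((P ⇒ᵖ ¬ᵖ Q) ⇒ᵖ Q ⇒ᵖ ¬ᵖ P) (conj s ∷ φ ∷ [])) t) ⊢φ)

    mp-∈ : ∀ {φ ψ} → Γ (φ ⇒ ψ) → Γ φ → Γ ψ
    mp-∈ {φ} {ψ} φ⇒ψ∈ φ∈ = ∈-intro λ {s} s⊆ t →
      refute (φ⇒ψ∈ ∷ φ∈ ∷ s⊆)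
             (mp (tautology ((R ⇒ᵖ ¬ᵖ Q) ⇒ᵖ ¬ᵖ ((P ⇒ᵖ Q) ∧ᵖ (P ∧ᵖ R))) (φ ∷ ψ ∷ conj s ∷ [])) t)

    ⇒-∈ : ∀ {φ ψ} → Thm (φ ⇒ ψ) → Γ φ → Γ ψ
    ⇒-∈ ⊢φ⇒ψ = mp-∈ (thm-∈ ⊢φ⇒ψ)

    ∧-∈ : ∀ {φ ψ} → Γ φ → Γ ψ → Γ (φ ∧' ψ)
    ∧-∈ {φ} {ψ} φ∈ = mp-∈ (⇒-∈ (tautology (P ⇒ᵖ Q ⇒ᵖ P ∧ᵖ Q) (φ ∷ ψ ∷ [])) φ∈)

    conj-∈ : ∀ {l} → All Γ l → Γ (conj l)
    conj-∈ []         = thm-∈ (tautology (⊤ᵖ P) (var 0 ∷ []))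
    conj-∈ (x∈ ∷ l⊆) = ∧-∈ x∈ (conj-∈ l⊆)

    ~∈⇒∉ : ∀ {φ} → Γ (~ φ) → ¬ Γ φ
    ~∈⇒∉ {φ} ~φ∈ φ∈ =
      refute (φ∈ ∷ ~φ∈ ∷ []) (tautology (¬ᵖ (P ∧ᵖ (¬ᵖ P ∧ᵖ ⊤ᵖ Q))) (φ ∷ var 0 ∷ []))

    ~∉⇒∈ : ∀ {φ} → ¬ Γ (~ φ) → Γ φ
    ~∉⇒∈ ~φ∉ = ∈-intro λ s⊆ ⊢s⇒~φ → ~φ∉ (⇒-∈ ⊢s⇒~φ (conj-∈ s⊆))

  open MaxConsistentSet

  axB : ∀ b φ → Thm (φ ⇒ ⟦ b ⟧ (~ ⟦ b ⟧ (~ φ)))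
  axB b φ = mp (mp (tautology ((Q ⇒ᵖ ¬ᵖ P) ⇒ᵖ (¬ᵖ Q ⇒ᵖ R) ⇒ᵖ P ⇒ᵖ R)
                              (φ ∷ ⟦ b ⟧ (~ φ) ∷ ⟦ b ⟧ (~ ⟦ b ⟧ (~ φ)) ∷ []))
                   (axT b (~ φ)))
               (ax5 b φ)

  ⟦⟧-~~ : ∀ b φ → Thm (⟦ b ⟧ φ ⇒ ⟦ b ⟧ (~ ~ φ))
  ⟦⟧-~~ b φ = mp (axK b φ (~ ~ φ)) (necB b (tautology (P ⇒ᵖ ¬ᵖ ¬ᵖ P) (φ ∷ [])))

  Canonical : S5Box {n} → Rel (Sc {n}) lzero
  Canonical b w v = ∀ φ → w ∋ ⟦ b ⟧ φ → v ∋ φ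

  Canonical-isEquivalence : ∀ b → IsEquivalence (Canonical b)
  Canonical-isEquivalence b = record
    { refl = λ {w} → reflexive {w}
    ; sym = λ {w u} → symmetric {w} {u}
    ; trans = λ {w u x} → transitive {w} {u} {x}
    }
    where
    reflexive : Reflexive (Canonical b)
    reflexive {_ , mc} φ = ⇒-∈ mc (axT b φ)

    transitive : Transitive (Canonical b)
    transitive {_ , mc} wRu uRx φ ⟦b⟧φ∈ = uRx φ (wRu (⟦ b ⟧ φ) (⇒-∈ mc (ax4 b φ) ⟦b⟧φ∈))

    -- By axiom B, ~ φ ∈ w would put ~ ⟦ b ⟧ (~ ~ φ) into u.
    symmetric : Symmetric (Canonical b)
    symmetric {_ , mcw} {_ , mcu} wRu φ ⟦b⟧φ∈u = ~∉⇒∈ mcw λ ~φ∈w →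
      ~∈⇒∉ mcu (wRu _ (⇒-∈ mcw (axB b (~ φ)) ~φ∈w)) (⇒-∈ mcu (⟦⟧-~~ b φ) ⟦b⟧φ∈u)

lemma9 : (n : ℕ) (Sg : List (Fm n)) → FiltrationReady Sg →
           ∀ w v → ((Sim Sg ∘ᴿ Rc) w v ⇔ (Rc ∘ᴿ Sim Sg) w v)
lemma9 n Sg _ = Similar-∘-comm (Canonical-isEquivalence bx) (SameΣ Sg)
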